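{- Let $F=\begin{bmatrix}1&0&0\\0&1&1\end{bmatrix}$ and let $A$ be a simple $(0,1)$-matrix with $F\not\prec A$ and $I_2\prec A$. Then, after permuting rows and columns, $A=\begin{bmatrix}A_1&0&0\\1&B&0\\1&1&A_2\end{bmatrix}$, where each $0$ (resp. $1$) denotes an all-zero (resp. all-one) block of the appropriate size, $A_1$ and $A_2$ are simple matrices with $F\not\prec A_1$ and $F\not\prec A_2$ (some blocks may have no rows or no columns), and $B$ contains $I_l$ or $I_l^c$ as a set of its rows for some $l\ge2$, with all other rows of $B$ being copies of rows of that $I_l$ or $I_l^c$.
   Context: A $(0,1)$-matrix is simple if it has no repeated columns. $F\prec A$ means some submatrix of $A$ is a row and column permutation of $F$. $I_l$ is the $l\times l$ identity matrix and $I_l^c$ its $(0,1)$-complement. -}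

module Defs where

open import Data.Nat using (ℕ; _≤_)
open import Data.Fin using (Fin; zero; suc; splitAt; _≟_)
open import Data.Fin.Permutation using (Permutation; _⟨$⟩ʳ_)
open import Data.Bool using (Bool; true; false; not)
open import Data.Sum using (_⊎_; inj₁; inj₂)
open import Data.Product using (Σ; ∃; ∃-syntax; _×_; _,_)
open import Relation.Nullary using (¬_)
open import Relation.Nullary.Decidable using (⌊_⌋)
open import Relation.Binary.PropositionalEquality using (_≡_)
open import Function.Definitions using (Injective)

Mat : ℕ → ℕ → Set
Mat m n = Fin m → Fin n → Bool

Simple : ∀ {m n} → Mat m n → Set
Simple {m} {n} A = ∀ (j j' : Fin n) → (∀ (i : Fin m) → A i j ≡ A i j') → j ≡ j'

-- F ≺ A : some submatrix of A is a row and column permutation of F,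
-- i.e. there are injective row and column maps embedding F into A.
_≺_ : ∀ {p q m n} → Mat p q → Mat m n → Set
_≺_ {p} {q} {m} {n} F A =
  Σ (Fin p → Fin m) λ ρ → Σ (Fin q → Fin n) λ κ →
    Injective _≡_ _≡_ ρ × Injective _≡_ _≡_ κ ×
    (∀ i j → F i j ≡ A (ρ i) (κ j))

I : (l : ℕ) → Mat l l
I l i j = ⌊ i ≟ j ⌋

Ic : (l : ℕ) → Mat l l
Ic l i j = not (I l i j)

F : Mat 2 3
F zero zero = true
F zero (suc _) = false
F (suc _) zero = false
F (suc _) (suc _) = true

RowsAre : ∀ {r l} → Mat r l → Mat l l → Set
RowsAre {r} {l} B M =
  (∀ (k : Fin l) → ∃[ s ] (∀ j → B s j ≡ M k j)) ×
  (∀ (s : Fin r) → ∃[ k ] (∀ j → B s j ≡ M k j))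

Block : ∀ {r₁ n₁ rB l r₂ n₂} → Mat r₁ n₁ → Mat rB l → Mat r₂ n₂ →
        Mat (r₁ Data.Nat.+ (rB Data.Nat.+ r₂)) (n₁ Data.Nat.+ (l Data.Nat.+ n₂))
Block {r₁} {n₁} {rB} {l} {r₂} {n₂} A₁ B A₂ i j with splitAt r₁ i | splitAt n₁ j
... | inj₁ i₁ | inj₁ j₁ = A₁ i₁ j₁
... | inj₁ _  | inj₂ _  = false
... | inj₂ i' | inj₁ _  = true
... | inj₂ i' | inj₂ j' with splitAt rB i' | splitAt l j'
...   | inj₁ iB | inj₁ jB = B iB jB
...   | inj₁ _  | inj₂ _  = false
...   | inj₂ _  | inj₁ _  = true
...   | inj₂ i₂ | inj₂ j₂ = A₂ i₂ j₂

-- Fix an I₂ in rows a, b and columns c, d, and call a column common if a and b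
-- are both 1 there. Against the pairs (a, c) and (b, d), F-freeness
-- forces a row that is not 1 on both c and d to have at most one 1 outside the
-- common columns, and to be 1 on all common columns if it has one. This sorts the
-- rows into A₁-rows (support inside the common columns), B-rows (exactly one 1
-- outside them) and A₂-rows (1 on c and d), and the columns into the common ones,
-- those hit by a B-row, and the rest; every off-diagonal block is then constant,
-- provided each A₂-row is 1 on the common columns. If some row 1 on c and d is 0
-- at a common column, F-freeness gives the same proviso for the complementary
-- matrix with a and b exchanged, and complementing swaps A₁ with A₂ and I_l with
-- I_l^c.
module Submission where

open import Defs
open import Data.Nat using (ℕ; zero; suc; _+_; _≤_; z≤n; s≤s)
open import Data.Fin using (Fin; zero; suc; splitAt; _≟_)
open import Data.Fin.Properties using (suc-injective; +↔⊎; any?)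
open import Data.Fin.Permutation using (Permutation; _⟨$⟩ʳ_)
open import Data.Bool using (Bool; true; false; not; _∧_; _xor_) renaming (_≟_ to _≟ᵇ_)
open import Data.Bool.Properties using (¬-not; ∧-conical; not-injective; not-involutive; not-distribˡ-xor)
open import Data.Sum using (_⊎_; inj₁; inj₂; [_,_]′)
open import Data.Sum.Function.Propositional using (_⊎-↔_)
open import Data.Product using (Σ; ∃; ∃₂; _×_; _,_; proj₁; proj₂)
open import Function using (_∘_)
open import Function.Bundles using (_↔_; mk↔ₛ′; mk⇔)
open import Function.Definitions using (Injective)
open import Function.Properties.Inverse using (↔-refl; ↔-trans)
import Function.Construct.Composition as Compose
open import Data.Empty using (⊥; ⊥-elim)
open import Relation.Nullary using (¬_; yes; no; contradiction)
open import Relation.Nullary.Decidable using (⌊_⌋; _×-dec_; isYes≗does; does-⇔)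
open import Relation.Unary using (Pred; Decidable)
open import Relation.Binary.Definitions using (DecidableEquality)
open import Relation.Binary.PropositionalEquality using (_≡_; _≢_; refl; sym; trans; cong; cong₂; subst)

record Enumeration {m p} (P : Pred (Fin m) p) : Set p where
  field
    size : ℕ
    elem : Fin size → Fin m
    elem-injective : Injective _≡_ _≡_ elem
    elem-satisfies : ∀ i → P (elem i)
    elem-onto : ∀ {y} → P y → ∃ λ i → elem i ≡ y

enumerate : ∀ {m p} {P : Pred (Fin m) p} → Decidable P → Enumeration P
enumerate {zero} P? = record
  { size = 0 ; elem = λ () ; elem-injective = λ {} ; elem-satisfies = λ () ; elem-onto = λ {} }
enumerate {suc m} {P = P} P? with enumerate (P? ∘ suc) | P? zero
... | E | yes P0 = record
  { size = suc size ; elem = elem′ ; elem-injective = injective′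
  ; elem-satisfies = satisfies′ ; elem-onto = onto′ }
  where
  open Enumeration E
  elem′ : Fin (suc size) → Fin (suc m)
  elem′ zero = zero
  elem′ (suc i) = suc (elem i)
  injective′ : Injective _≡_ _≡_ elem′
  injective′ {zero} {zero} _ = refl
  injective′ {suc i} {suc j} e = cong suc (elem-injective (suc-injective e))
  satisfies′ : ∀ i → P (elem′ i)
  satisfies′ zero = P0
  satisfies′ (suc i) = elem-satisfies i
  onto′ : ∀ {y} → P y → ∃ λ i → elem′ i ≡ y
  onto′ {zero} _ = zero , refl
  onto′ {suc y} Py with elem-onto Py
  ... | i , e = suc i , cong suc e
... | E | no ¬P0 = record
  { size = size ; elem = suc ∘ elem ; elem-injective = elem-injective ∘ suc-injective
  ; elem-satisfies = elem-satisfies ; elem-onto = onto′ }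
  where
  open Enumeration E
  onto′ : ∀ {y} → P y → ∃ λ i → suc (elem i) ≡ y
  onto′ {zero} P0 = contradiction P0 ¬P0
  onto′ {suc y} Py with elem-onto Py
  ... | i , e = i , cong suc e

⌊≟⌋-injective : ∀ {k n} {f : Fin k → Fin n} → Injective _≡_ _≡_ f →
                ∀ i j → ⌊ f i ≟ f j ⌋ ≡ ⌊ i ≟ j ⌋
⌊≟⌋-injective {f = f} f-injective i j =
  trans (isYes≗does (f i ≟ f j))
    (trans (does-⇔ (mk⇔ f-injective (cong f)) (f i ≟ f j) (i ≟ j)) (sym (isYes≗does (i ≟ j))))

distinct⇒2≤ : ∀ {l} {i j : Fin l} → i ≢ j → 2 ≤ l
distinct⇒2≤ {suc zero} {zero} {zero} i≢j = contradiction refl i≢j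
distinct⇒2≤ {suc (suc _)} _ = s≤s (s≤s z≤n)

-- The diagonal blocks A₁, B, A₂; off them, an entry of [A₁ 0 0; 1 B 0; 1 1 A₂]
-- is 1 exactly when its row part lies below its column part.
data Part : Set where
  top mid bot : Part

_≟ₚ_ : DecidableEquality Part
top ≟ₚ top = yes refl
top ≟ₚ mid = no λ ()
top ≟ₚ bot = no λ ()
mid ≟ₚ top = no λ ()
mid ≟ₚ mid = yes refl
mid ≟ₚ bot = no λ ()
bot ≟ₚ top = no λ ()
bot ≟ₚ mid = no λ ()
bot ≟ₚ bot = yes refl

_>ₚ_ : Part → Part → Bool
mid >ₚ top = true
bot >ₚ top = true
bot >ₚ mid = true
_   >ₚ _   = false

opposite : Part → Part
opposite top = bot
opposite mid = mid
opposite bot = top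

opposite->ₚ : ∀ X Y → X ≢ Y → opposite X >ₚ opposite Y ≡ not (X >ₚ Y)
opposite->ₚ top top X≢Y = contradiction refl X≢Y
opposite->ₚ mid mid X≢Y = contradiction refl X≢Y
opposite->ₚ bot bot X≢Y = contradiction refl X≢Y
opposite->ₚ top mid _ = refl
opposite->ₚ top bot _ = refl
opposite->ₚ mid top _ = refl
opposite->ₚ mid bot _ = refl
opposite->ₚ bot top _ = refl
opposite->ₚ bot mid _ = refl

opposite-mid : ∀ {X} → opposite X ≡ mid → X ≡ mid
opposite-mid {mid} _ = refl

module Sort {m} (part : Fin m → Part) where

  module Fibre (X : Part) = Enumeration (enumerate (λ y → part y ≟ₚ X))
  open Fibre public

  Sorted : Set
  Sorted = Fin (size top) ⊎ (Fin (size mid) ⊎ Fin (size bot))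

  tag : (X : Part) → Fin (size X) → Sorted
  tag top = inj₁
  tag mid = inj₂ ∘ inj₁
  tag bot = inj₂ ∘ inj₂

  untag : Sorted → Fin m
  untag = [ elem top , [ elem mid , elem bot ]′ ]′

  untag-tag : ∀ X i → untag (tag X i) ≡ elem X i
  untag-tag top i = refl
  untag-tag mid i = refl
  untag-tag bot i = refl

  position : ∀ {X y} → part y ≡ X → Sorted
  position {X} p = tag X (proj₁ (elem-onto X p))

  position-elem : ∀ X i {Y} (p : part (elem X i) ≡ Y) → position p ≡ tag X i
  position-elem X i p with refl ← trans (sym p) (elem-satisfies X i) =
    cong (tag X) (elem-injective X (proj₂ (elem-onto X p)))

  sorted : Sorted ↔ Fin m
  sorted = mk↔ₛ′ untag (λ y → position {part y} refl) untag-position position-untag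
    where
    untag-position : ∀ y → untag (position {part y} refl) ≡ y
    untag-position y = trans (untag-tag (part y) _) (proj₂ (elem-onto (part y) refl))
    position-untag : ∀ u → position {part (untag u)} refl ≡ u
    position-untag (inj₁ i) = position-elem top i refl
    position-untag (inj₂ (inj₁ i)) = position-elem mid i refl
    position-untag (inj₂ (inj₂ i)) = position-elem bot i refl

  permutation : Permutation (size top + (size mid + size bot)) m
  permutation = ↔-trans (↔-trans +↔⊎ (↔-refl ⊎-↔ +↔⊎)) sorted

≺-trans : ∀ {p q r s m n} {F : Mat p q} {G : Mat r s} {A : Mat m n} → F ≺ G → G ≺ A → F ≺ A
≺-trans (ρ , κ , ρ-inj , κ-inj , F≡G) (ρ′ , κ′ , ρ′-inj , κ′-inj , G≡A) =
  ρ′ ∘ ρ , κ′ ∘ κ ,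
  Compose.injective _≡_ _≡_ _≡_ ρ-inj ρ′-inj , Compose.injective _≡_ _≡_ _≡_ κ-inj κ′-inj ,
  λ i j → trans (F≡G i j) (G≡A (ρ i) (κ j))

submatrix-≺ : ∀ {r s m n} (A : Mat m n) {g : Fin r → Fin m} {h : Fin s → Fin n} →
              Injective _≡_ _≡_ g → Injective _≡_ _≡_ h → (λ i j → A (g i) (h j)) ≺ A
submatrix-≺ A {g} {h} g-inj h-inj = g , h , g-inj , h-inj , λ _ _ → refl

record Decomposition {m n} (A : Mat m n) : Set where
  field
    rowPart : Fin m → Part
    colPart : Fin n → Part
    off-diagonal : ∀ s x → rowPart s ≢ colPart x → A s x ≡ rowPart s >ₚ colPart x
    complemented : Bool
    pivot : Fin m → Fin n  -- only meaningful on middle rows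
    pivot-mid : ∀ {s} → rowPart s ≡ mid → colPart (pivot s) ≡ mid
    pivot-onto : ∀ {x} → colPart x ≡ mid → ∃ λ s → rowPart s ≡ mid × pivot s ≡ x
    middle-block : ∀ {s x} → rowPart s ≡ mid → colPart x ≡ mid →
                   A s x ≡ complemented xor ⌊ pivot s ≟ x ⌋
    two-mid-columns : ∃₂ λ x y → x ≢ y × colPart x ≡ mid × colPart y ≡ mid

  off-diagonal′ : ∀ {s x X Y} → rowPart s ≡ X → colPart x ≡ Y → X ≢ Y → A s x ≡ X >ₚ Y
  off-diagonal′ refl refl = off-diagonal _ _

HasBlockForm : ∀ {m n} → Mat m n → Set
HasBlockForm {m} {n} A =
  Σ ℕ λ r₁ → Σ ℕ λ rB → Σ ℕ λ r₂ → Σ ℕ λ n₁ → Σ ℕ λ l → Σ ℕ λ n₂ →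
  Σ (Mat r₁ n₁) λ A₁ → Σ (Mat rB l) λ B → Σ (Mat r₂ n₂) λ A₂ →
  Σ (Permutation (r₁ + (rB + r₂)) m) λ σ →
  Σ (Permutation (n₁ + (l + n₂)) n) λ τ →
    (∀ i j → A (σ ⟨$⟩ʳ i) (τ ⟨$⟩ʳ j) ≡ Block A₁ B A₂ i j) ×
    Simple A₁ × ¬ (F ≺ A₁) × Simple A₂ × ¬ (F ≺ A₂) ×
    2 ≤ l × (RowsAre B (I l) ⊎ RowsAre B (Ic l))

module Blocks {m n} {A : Mat m n} (D : Decomposition A) where
  open Decomposition D
  module R = Sort rowPart
  module C = Sort colPart

  diagonal : (X : Part) → Mat (R.size X) (C.size X)
  diagonal X i j = A (R.elem X i) (C.elem X j)

  off-diagonal-entry : ∀ X Y → X ≢ Y → ∀ i j → A (R.elem X i) (C.elem Y j) ≡ X >ₚ Y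
  off-diagonal-entry X Y X≢Y i j = off-diagonal′ (R.elem-satisfies X i) (C.elem-satisfies Y j) X≢Y

  block : ∀ i j → A (R.permutation ⟨$⟩ʳ i) (C.permutation ⟨$⟩ʳ j) ≡
                  Block (diagonal top) (diagonal mid) (diagonal bot) i j
  block i j with splitAt (R.size top) i | splitAt (C.size top) j
  ... | inj₁ i₁ | inj₁ j₁ = refl
  ... | inj₁ i₁ | inj₂ j′ with splitAt (C.size mid) j′
  ...   | inj₁ jB = off-diagonal-entry top mid (λ ()) i₁ jB
  ...   | inj₂ j₂ = off-diagonal-entry top bot (λ ()) i₁ j₂
  block i j | inj₂ i′ | inj₁ j₁ with splitAt (R.size mid) i′
  ...   | inj₁ iB = off-diagonal-entry mid top (λ ()) iB j₁
  ...   | inj₂ i₂ = off-diagonal-entry bot top (λ ()) i₂ j₁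
  block i j | inj₂ i′ | inj₂ j′ with splitAt (R.size mid) i′ | splitAt (C.size mid) j′
  ... | inj₁ iB | inj₁ jB = refl
  ... | inj₁ iB | inj₂ j₂ = off-diagonal-entry mid bot (λ ()) iB j₂
  ... | inj₂ i₂ | inj₁ jB = off-diagonal-entry bot mid (λ ()) i₂ jB
  ... | inj₂ i₂ | inj₂ j₂ = refl

  diagonal-F-free : ¬ (F ≺ A) → ∀ X → ¬ (F ≺ diagonal X)
  diagonal-F-free F⊀A X F≺ =
    F⊀A (≺-trans {G = diagonal X} {A = A} F≺ (submatrix-≺ A (R.elem-injective X) (C.elem-injective X)))

  -- Off the rows of part X, a column of part X is constant.
  diagonal-simple : Simple A → ∀ X → Simple (diagonal X)
  diagonal-simple simple X j j′ same = C.elem-injective X (simple _ _ agree)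
    where
    agree : ∀ s → A s (C.elem X j) ≡ A s (C.elem X j′)
    agree s with rowPart s ≟ₚ X
    ... | no s∉X = trans (off-diagonal′ refl (C.elem-satisfies X j) s∉X)
                         (sym (off-diagonal′ refl (C.elem-satisfies X j′) s∉X))
    ... | yes s∈X with R.elem-onto X s∈X
    ...   | i , refl = same i

  middle-row : ∀ s k → pivot (R.elem mid s) ≡ C.elem mid k →
               ∀ j → diagonal mid s j ≡ complemented xor I (C.size mid) k j
  middle-row s k pivot≡k j =
    trans (middle-block (R.elem-satisfies mid s) (C.elem-satisfies mid j))
      (cong (complemented xor_)
        (trans (cong (λ y → ⌊ y ≟ C.elem mid j ⌋) pivot≡k)
               (⌊≟⌋-injective (C.elem-injective mid) k j)))

  middle-rows : RowsAre (diagonal mid) (λ k j → complemented xor I (C.size mid) k j)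
  middle-rows = every-row-occurs , every-row-is-a-copy
    where
    every-row-occurs : ∀ k → ∃ λ s → ∀ j → diagonal mid s j ≡ complemented xor I (C.size mid) k j
    every-row-occurs k with pivot-onto (C.elem-satisfies mid k)
    ... | y , y∈mid , pivot≡k with R.elem-onto mid y∈mid
    ...   | s , refl = s , middle-row s k pivot≡k
    every-row-is-a-copy : ∀ s → ∃ λ k → ∀ j → diagonal mid s j ≡ complemented xor I (C.size mid) k j
    every-row-is-a-copy s with C.elem-onto mid (pivot-mid (R.elem-satisfies mid s))
    ... | k , k≡pivot = k , middle-row s k (sym k≡pivot)

  2≤middle-width : 2 ≤ C.size mid
  2≤middle-width with two-mid-columns
  ... | x , y , x≢y , x∈mid , y∈mid with C.elem-onto mid x∈mid | C.elem-onto mid y∈mid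
  ...   | i , refl | j , refl = distinct⇒2≤ (x≢y ∘ cong (C.elem mid))

identity-or-complement : ∀ {r l} {B : Mat r l} p →
  RowsAre B (λ k j → p xor I l k j) → RowsAre B (I l) ⊎ RowsAre B (Ic l)
identity-or-complement false = inj₁
identity-or-complement true = inj₂

decomposition⇒block-form : ∀ {m n} {A : Mat m n} →
  Simple A → ¬ (F ≺ A) → Decomposition A → HasBlockForm A
decomposition⇒block-form simple F⊀A D =
  R.size top , R.size mid , R.size bot , C.size top , C.size mid , C.size bot ,
  diagonal top , diagonal mid , diagonal bot , R.permutation , C.permutation , block ,
  diagonal-simple simple top , diagonal-F-free F⊀A top ,
  diagonal-simple simple bot , diagonal-F-free F⊀A bot ,
  2≤middle-width , identity-or-complement (Decomposition.complemented D) middle-rows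
  where open Blocks D

F-Free : ∀ {m n} → Mat m n → Set
F-Free {m} {n} A = ∀ (r s : Fin m) (x y z : Fin n) →
  A r x ≡ true → A r y ≡ false → A r z ≡ false →
  A s x ≡ false → A s y ≡ true → A s z ≡ true → y ≡ z

¬≺⇒F-Free : ∀ {m n} {A : Mat m n} → ¬ (F ≺ A) → F-Free A
¬≺⇒F-Free {A = A} F⊀A r s x y z rx ry rz sx sy sz with y ≟ z
... | yes y≡z = y≡z
... | no y≢z = contradiction embedding F⊀A
  where
  ρ : Fin 2 → _
  ρ zero = r
  ρ (suc _) = s
  κ : Fin 3 → _
  κ zero = x
  κ (suc zero) = y
  κ (suc (suc _)) = z
  agree : ∀ i j → F i j ≡ A (ρ i) (κ j)
  agree zero zero = sym rx
  agree zero (suc zero) = sym ry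
  agree zero (suc (suc zero)) = sym rz
  agree (suc zero) zero = sym sx
  agree (suc zero) (suc zero) = sym sy
  agree (suc zero) (suc (suc zero)) = sym sz
  -- F's entries tell apart all its rows and columns except columns 1 and 2.
  separated : ∀ {i i′ j j′} → F i j ≢ F i′ j′ → ρ i ≡ ρ i′ → κ j ≡ κ j′ → ⊥
  separated {i} {i′} {j} {j′} F≢ ρ≡ κ≡ =
    contradiction (trans (agree i j) (trans (cong₂ A ρ≡ κ≡) (sym (agree i′ j′)))) F≢
  ρ-injective : Injective _≡_ _≡_ ρ
  ρ-injective {zero} {zero} _ = refl
  ρ-injective {suc zero} {suc zero} _ = refl
  ρ-injective {zero} {suc zero} e = ⊥-elim (separated {zero} {suc zero} {zero} {zero} (λ ()) e refl)
  ρ-injective {suc zero} {zero} e = ⊥-elim (separated {suc zero} {zero} {zero} {zero} (λ ()) e refl)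
  κ-injective : Injective _≡_ _≡_ κ
  κ-injective {zero} {zero} _ = refl
  κ-injective {suc zero} {suc zero} _ = refl
  κ-injective {suc (suc zero)} {suc (suc zero)} _ = refl
  κ-injective {suc zero} {suc (suc zero)} e = contradiction e y≢z
  κ-injective {suc (suc zero)} {suc zero} e = contradiction (sym e) y≢z
  κ-injective {zero} {suc j} e = ⊥-elim (separated {zero} {zero} {zero} {suc j} (λ ()) refl e)
  κ-injective {suc j} {zero} e = ⊥-elim (separated {zero} {zero} {suc j} {zero} (λ ()) refl e)
  embedding : F ≺ A
  embedding = ρ , κ , ρ-injective , κ-injective , agree

complement : ∀ {m n} → Mat m n → Mat m n
complement A s x = not (A s x)

complement-F-Free : ∀ {m n} {A : Mat m n} → F-Free A → F-Free (complement A)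
complement-F-Free free r s x y z rx ry rz sx sy sz =
  free s r x y z (not-injective sx) (not-injective sy) (not-injective sz)
                 (not-injective rx) (not-injective ry) (not-injective rz)

separates : ∀ {ℓ} {X : Set ℓ} (f : X → Bool) {y z} → f y ≡ true → f z ≡ false → y ≢ z
separates f fy fz refl = contradiction (trans (sym fy) fz) λ ()

Covers : ∀ {m n} → Mat m n → Fin m → Fin m → Fin n → Fin n → Set
Covers {m} {n} A a b c d = ∀ {s : Fin m} {x : Fin n} →
  A s c ≡ true → A s d ≡ true → A a x ≡ true → A b x ≡ true → A s x ≡ true

module I₂Configuration {m n} {A : Mat m n} (free : F-Free A) {a b : Fin m} {c d : Fin n}
  (ac : A a c ≡ true) (ad : A a d ≡ false) (bc : A b c ≡ false) (bd : A b d ≡ true) where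

  c≢d : c ≢ d
  c≢d = separates (A a) ac ad

  common : Fin n → Bool
  common x = A a x ∧ A b x

  common-c : common c ≡ false
  common-c = trans (cong (_∧ A b c) ac) bc

  common-d : common d ≡ false
  common-d = cong (_∧ A b d) ad

  a-outside-zero : ∀ {x} → common x ≡ false → x ≢ c → A a x ≡ false
  a-outside-zero {x} kx x≢c with A a x in ax
  ... | false = refl
  ... | true = contradiction (sym (free b a d c x bd bc kx ad ac ax)) x≢c

  b-outside-zero : ∀ {x} → common x ≡ false → x ≢ d → A b x ≡ false
  b-outside-zero {x} kx x≢d with A b x in bx | A a x in ax
  ... | false | _ = refl
  ... | true | false = contradiction (sym (free a b c d x ac ad ax bc bd bx)) x≢d
  ... | true | true = contradiction kx λ ()

  Outside : Fin m → Fin n → Set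
  Outside s x = A s x ≡ true × common x ≡ false

  NotBottom : Fin m → Set
  NotBottom s = A s c ≡ false ⊎ A s d ≡ false

  -- (a, c) if s is 0 at c, else (b, d): the pair the F-freeness arguments about s run against.
  record Guard (s : Fin m) : Set where
    field
      row : Fin m
      col : Fin n
      row-col : A row col ≡ true
      s-col : A s col ≡ false
      col-uncommon : common col ≡ false
      row-common : ∀ {x} → common x ≡ true → A row x ≡ true
      row-outside-zero : ∀ {x} → common x ≡ false → x ≢ col → A row x ≡ false

  guard : ∀ {s} → NotBottom s → Guard s
  guard (inj₁ sc) = record
    { row = a ; col = c ; row-col = ac ; s-col = sc ; col-uncommon = common-c
    ; row-common = proj₁ ∧-conical _ _ ; row-outside-zero = a-outside-zero }
  guard (inj₂ sd) = record
    { row = b ; col = d ; row-col = bd ; s-col = sd ; col-uncommon = common-d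
    ; row-common = proj₂ ∧-conical _ _ ; row-outside-zero = b-outside-zero }

  outside-unique : ∀ {s y z} → NotBottom s → Outside s y → Outside s z → y ≡ z
  outside-unique {s} nb (sy , ky) (sz , kz) =
    free row s col _ _ row-col (row-outside-zero ky (separates (A s) sy s-col))
         (row-outside-zero kz (separates (A s) sz s-col)) s-col sy sz
    where open Guard (guard nb)

  outside⇒covers-common : ∀ {s y x} → NotBottom s → Outside s y → common x ≡ true → A s x ≡ true
  outside⇒covers-common {s} {y} {x} nb (sy , ky) kx = ¬-not λ sx →
    separates common kx col-uncommon
      (free s row y x col sy sx s-col (row-outside-zero ky (separates (A s) sy s-col)) (row-common kx) row-col)
    where open Guard (guard nb)

  bottom-covers-outside : ∀ {s t x} → A s c ≡ true → A s d ≡ true →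
                          NotBottom t → Outside t x → A s x ≡ true
  bottom-covers-outside {s} {t} {x} sc sd nb o@(tx , _) with A t c ≟ᵇ true | A t d ≟ᵇ true
  ... | yes tc | _ = subst (λ y → A s y ≡ true) (outside-unique nb (tc , common-c) o) sc
  ... | _ | yes td = subst (λ y → A s y ≡ true) (outside-unique nb (td , common-d) o) sd
  ... | no tc | no td = ¬-not λ sx → c≢d (free t s x c d tx (¬-not tc) (¬-not td) sx sc sd)

  covers-or-complement-covers : Covers A a b c d ⊎ Covers (complement A) b a c d
  covers-or-complement-covers with any? (λ s → any? λ x →
    (A s c ≟ᵇ true) ×-dec (A s d ≟ᵇ true) ×-dec (A a x ≟ᵇ true) ×-dec (A b x ≟ᵇ true) ×-dec
    (A s x ≟ᵇ false))
  ... | no none = inj₁ λ sc sd ax bx → ¬-not λ sx → none (_ , _ , sc , sd , ax , bx , sx)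
  ... | yes (s₀ , x₀ , s₀c , s₀d , ax₀ , bx₀ , s₀x₀) = inj₂ λ sc sd bx ax →
    cong not (zero-below-zeros (not-injective sc) (not-injective sd) (not-injective ax) (not-injective bx))
    where
    zero-below-zeros : ∀ {s x} → A s c ≡ false → A s d ≡ false →
                       A a x ≡ false → A b x ≡ false → A s x ≡ false
    zero-below-zeros {s} {x} sc sd ax bx = ¬-not λ sx → c≢d (free s s₀ x c d sx sc sd s₀x s₀c s₀d)
      where
      s₀x : A s₀ x ≡ false
      s₀x = ¬-not λ s₀x → separates (A b) bd bx (free a s₀ x₀ d x ax₀ ad ax s₀x₀ s₀d s₀x)

  Bottom : Fin m → Set
  Bottom s = A s c ≡ true × A s d ≡ true

  bottom-or-not : ∀ s → Bottom s ⊎ NotBottom s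
  bottom-or-not s with A s c ≟ᵇ true | A s d ≟ᵇ true
  ... | yes sc | yes sd = inj₁ (sc , sd)
  ... | no sc | _ = inj₂ (inj₁ (¬-not sc))
  ... | yes _ | no sd = inj₂ (inj₂ (¬-not sd))

  bottom⇒¬NotBottom : ∀ {s} → Bottom s → ¬ NotBottom s
  bottom⇒¬NotBottom (sc , _) (inj₁ sc′) = separates (A _) sc sc′ refl
  bottom⇒¬NotBottom (_ , sd) (inj₂ sd′) = separates (A _) sd sd′ refl

  data RowKind (s : Fin m) : Part → Set where
    top : (∀ {x} → A s x ≡ true → common x ≡ true) → RowKind s top
    mid : NotBottom s → ∀ x → Outside s x → RowKind s mid
    bot : Bottom s → RowKind s bot

  rowKind : ∀ s → ∃ (RowKind s)
  rowKind s with bottom-or-not s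
  ... | inj₁ bottom = bot , bot bottom
  ... | inj₂ nb with any? (λ x → (A s x ≟ᵇ true) ×-dec (common x ≟ᵇ false))
  ...   | yes (x , o) = mid , mid nb x o
  ...   | no none = top , top λ sx → ¬-not λ kx → none (_ , sx , kx)

  rowPart : Fin m → Part
  rowPart s = proj₁ (rowKind s)

  rowKind-of : ∀ {s X} → rowPart s ≡ X → RowKind s X
  rowKind-of {s} refl = proj₂ (rowKind s)

  mid-NotBottom : ∀ {s} → rowPart s ≡ mid → NotBottom s
  mid-NotBottom p with rowKind-of p
  ... | mid nb _ _ = nb

  rowPart-mid : ∀ {s x} → NotBottom s → Outside s x → rowPart s ≡ mid
  rowPart-mid {s} nb (sx , kx) with rowKind s
  ... | top , top ⊆common = contradiction refl (separates common (⊆common sx) kx)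
  ... | mid , _ = refl
  ... | bot , bot bottom = contradiction nb (bottom⇒¬NotBottom bottom)

  top-row-zero : ∀ {s x} → (∀ {y} → A s y ≡ true → common y ≡ true) →
                 common x ≡ false → A s x ≡ false
  top-row-zero ⊆common kx = ¬-not λ sx → separates common (⊆common sx) kx refl

  data ColKind (x : Fin n) : Part → Set where
    top : common x ≡ true → ColKind x top
    mid : common x ≡ false → ∀ s → rowPart s ≡ mid → A s x ≡ true → ColKind x mid
    bot : common x ≡ false → (∀ {s} → rowPart s ≡ mid → A s x ≡ false) → ColKind x bot

  colKind : ∀ x → ∃ (ColKind x)
  colKind x with common x ≟ᵇ true
  ... | yes kx = top , top kx
  ... | no kx with any? (λ s → (rowPart s ≟ₚ mid) ×-dec (A s x ≟ᵇ true))
  ...   | yes (s , p , sx) = mid , mid (¬-not kx) s p sx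
  ...   | no none = bot , bot (¬-not kx) λ p → ¬-not λ sx → none (_ , p , sx)

  colPart : Fin n → Part
  colPart x = proj₁ (colKind x)

  colKind-of : ∀ {x X} → colPart x ≡ X → ColKind x X
  colKind-of {x} refl = proj₂ (colKind x)

  mid-uncommon : ∀ {x} → colPart x ≡ mid → common x ≡ false
  mid-uncommon q with colKind-of q
  ... | mid kx _ _ _ = kx

  colPart-mid : ∀ {s x} → common x ≡ false → rowPart s ≡ mid → A s x ≡ true → colPart x ≡ mid
  colPart-mid {s} {x} kx p sx with colKind x
  ... | top , top kx′ = contradiction refl (separates common kx′ kx)
  ... | mid , _ = refl
  ... | bot , bot _ mid-zero = contradiction refl (separates (A s) sx (mid-zero p))

  pivot : Fin m → Fin n
  pivot s with rowKind s
  ... | mid , mid _ x _ = x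
  ... | _ = c

  pivot-outside : ∀ {s} → rowPart s ≡ mid → Outside s (pivot s)
  pivot-outside {s} p with rowKind s | p
  ... | mid , mid _ _ o | _ = o
  ... | top , _ | ()
  ... | bot , _ | ()

  pivot-mid : ∀ {s} → rowPart s ≡ mid → colPart (pivot s) ≡ mid
  pivot-mid p = colPart-mid (proj₂ (pivot-outside p)) p (proj₁ (pivot-outside p))

  pivot-onto : ∀ {x} → colPart x ≡ mid → ∃ λ s → rowPart s ≡ mid × pivot s ≡ x
  pivot-onto q with colKind-of q
  ... | mid kx t p tx = t , p , outside-unique (mid-NotBottom p) (pivot-outside p) (tx , kx)

  middle-block : ∀ {s x} → rowPart s ≡ mid → colPart x ≡ mid →
                 A s x ≡ false xor ⌊ pivot s ≟ x ⌋
  middle-block {s} {x} p q with pivot s ≟ x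
  ... | yes refl = proj₁ (pivot-outside p)
  ... | no s↛x = ¬-not λ sx →
    s↛x (outside-unique (mid-NotBottom p) (pivot-outside p) (sx , mid-uncommon q))

  c-mid : colPart c ≡ mid
  c-mid = colPart-mid common-c (rowPart-mid (inj₂ ad) (ac , common-c)) ac

  d-mid : colPart d ≡ mid
  d-mid = colPart-mid common-d (rowPart-mid (inj₁ bc) (bd , common-d)) bd

  decomposition : Covers A a b c d → Decomposition A
  decomposition covers = record
    { rowPart = rowPart ; colPart = colPart ; off-diagonal = off-diagonal
    ; complemented = false ; pivot = pivot ; pivot-mid = pivot-mid ; pivot-onto = pivot-onto
    ; middle-block = middle-block ; two-mid-columns = c , d , c≢d , c-mid , d-mid }
    where
    off-diagonal : ∀ s x → rowPart s ≢ colPart x → A s x ≡ rowPart s >ₚ colPart x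
    off-diagonal s x ne with rowKind s | colKind x
    ... | top , top ⊆common | mid , mid kx _ _ _ = top-row-zero ⊆common kx
    ... | top , top ⊆common | bot , bot kx _ = top-row-zero ⊆common kx
    ... | mid , mid nb _ o | top , top kx = outside⇒covers-common nb o kx
    ... | mid , mid nb _ o | bot , bot _ mid-zero = mid-zero (rowPart-mid nb o)
    ... | bot , bot (sc , sd) | top , top kx =
      covers sc sd (proj₁ ∧-conical _ _ kx) (proj₂ ∧-conical _ _ kx)
    ... | bot , bot (sc , sd) | mid , mid kx t p tx = bottom-covers-outside sc sd (mid-NotBottom p) (tx , kx)
    ... | top , _ | top , _ = contradiction refl ne
    ... | mid , _ | mid , _ = contradiction refl ne
    ... | bot , _ | bot , _ = contradiction refl ne

not-≡-swap : ∀ {u v} → not u ≡ v → u ≡ not v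
not-≡-swap {u} e = trans (sym (not-involutive u)) (cong not e)

dualize : ∀ {m n} {A : Mat m n} → Decomposition (complement A) → Decomposition A
dualize D = record
  { rowPart = opposite ∘ rowPart
  ; colPart = opposite ∘ colPart
  ; off-diagonal = λ s x ne →
      trans (not-≡-swap (off-diagonal s x (ne ∘ cong opposite)))
            (sym (opposite->ₚ _ _ (ne ∘ cong opposite)))
  ; complemented = not complemented
  ; pivot = pivot
  ; pivot-mid = cong opposite ∘ pivot-mid ∘ opposite-mid
  ; pivot-onto = λ q → let s , p , e = pivot-onto (opposite-mid q) in s , cong opposite p , e
  ; middle-block = λ p q →
      trans (not-≡-swap (middle-block (opposite-mid p) (opposite-mid q))) (not-distribˡ-xor complemented _)
  ; two-mid-columns = let x , y , x≢y , px , py = two-mid-columns in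
      x , y , x≢y , cong opposite px , cong opposite py
  }
  where open Decomposition D

I₂≺⇒Decomposition : ∀ {m n} {A : Mat m n} → F-Free A → I 2 ≺ A → Decomposition A
I₂≺⇒Decomposition {A = A} free (ρ , κ , _ , _ , I≡A) =
  [ Config.decomposition , dualize ∘ ComplementConfig.decomposition ]′ Config.covers-or-complement-covers
  where
  ac : A (ρ zero) (κ zero) ≡ true
  ac = sym (I≡A zero zero)
  ad : A (ρ zero) (κ (suc zero)) ≡ false
  ad = sym (I≡A zero (suc zero))
  bc : A (ρ (suc zero)) (κ zero) ≡ false
  bc = sym (I≡A (suc zero) zero)
  bd : A (ρ (suc zero)) (κ (suc zero)) ≡ true
  bd = sym (I≡A (suc zero) (suc zero))
  module Config = I₂Configuration {A = A} free ac ad bc bd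
  module ComplementConfig = I₂Configuration {A = complement A} (complement-F-Free free)
    (cong not bc) (cong not bd) (cong not ac) (cong not ad)

lemma2p3 : ∀ {m n} (A : Mat m n) → Simple A → ¬ (F ≺ A) → I 2 ≺ A →
    Σ ℕ λ r₁ → Σ ℕ λ rB → Σ ℕ λ r₂ → Σ ℕ λ n₁ → Σ ℕ λ l → Σ ℕ λ n₂ →
    Σ (Mat r₁ n₁) λ A₁ → Σ (Mat rB l) λ B → Σ (Mat r₂ n₂) λ A₂ →
    Σ (Permutation (r₁ + (rB + r₂)) m) λ σ →
    Σ (Permutation (n₁ + (l + n₂)) n) λ τ →
      (∀ i j → A (σ ⟨$⟩ʳ i) (τ ⟨$⟩ʳ j) ≡ Block A₁ B A₂ i j) ×
      Simple A₁ × ¬ (F ≺ A₁) × Simple A₂ × ¬ (F ≺ A₂) ×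
      2 ≤ l × (RowsAre B (I l) ⊎ RowsAre B (Ic l))
lemma2p3 A simple F⊀A I₂≺A =
  decomposition⇒block-form simple F⊀A (I₂≺⇒Decomposition (¬≺⇒F-Free F⊀A) I₂≺A)
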